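{- For every integer $n \ge 0$, \[ H_{1}(n) = \sum_{k=0}^{n} \binom{n}{k} H(k), \] where, for a set $V$ of $m$ propositional variables, $H(m)$ is the number of distinct subsets of $\{0,1\}^m$ that arise as the set of Boolean solutions of some set of binomial equations $m_1 = m_2$ in which each $m_i$ is a nonempty product of variables of $V$ (neither the constant $1$ nor the constant $0$ is allowed), and $H_{1}(m)$ is the number of distinct subsets of $\{0,1\}^m$ that arise as the set of Boolean solutions of some set of binomial equations $m_1 = m_2$ in which each $m_i$ is a possibly empty product of variables of $V$ (the empty product being the constant $1$; the constant $0$ is not allowed).
   Context: Variables range over $\{0,1\}$, products are logical conjunctions, the empty product is $1$, and a vector in $\{0,1\}^m$ is a solution of a set of equations if it satisfies every equation in the set. Two sets of equations are counted as the same if they have the same solution set. For $m=0$, $\{0,1\}^0$ consists of the single empty vector. (Equivalently, $H(m)$ counts canonical systems of binomial equations with neither constant, corresponding to semilattices with $m$ generators, and $H_1(m)$ counts those where the constant $1$ may occur but not $0$.) -}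

module Defs where

open import Data.Nat using (ℕ; zero; suc; _+_; _*_)
open import Data.Nat.Combinatorics using (_C_)
open import Data.Bool using (Bool; true; false; _∧_)
open import Data.Fin using (Fin)
open import Data.Vec using (Vec; []; _∷_; lookup)
open import Data.List using (List; []; _∷_; length)
open import Data.List.Relation.Unary.All using (All)
open import Data.List.Relation.Unary.Unique.Propositional using (Unique)
open import Data.List.Membership.Propositional using (_∈_)
open import Data.Product using (_×_; _,_; Σ; ∃)
open import Relation.Binary.PropositionalEquality using (_≡_)
open import Relation.Nullary using (¬_)
open import Function.Bundles using (_⇔_)

Point : ℕ → Set
Point m = Vec Bool m

-- Canonical representation of a subset of {0,1}^m: its characteristic
-- function stored as a complete binary tree of depth m (so two subsets are
-- equal iff their representations are propositionally equal).
BSet : ℕ → Set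
BSet zero    = Bool
BSet (suc m) = BSet m × BSet m

mem : ∀ {m} → BSet m → Point m → Bool
mem {zero}  b        []          = b
mem {suc m} (t , f) (true  ∷ x) = mem t x
mem {suc m} (t , f) (false ∷ x) = mem f x

-- A monomial (product of variables) is a list of variables; the empty list
-- is the empty product, i.e. the constant 1.
Monomial : ℕ → Set
Monomial m = List (Fin m)

evalMon : ∀ {m} → Monomial m → Point m → Bool
evalMon []       x = true
evalMon (v ∷ vs) x = lookup x v ∧ evalMon vs x

Equation : ℕ → Set
Equation m = Monomial m × Monomial m

SatEq : ∀ {m} → Equation m → Point m → Set
SatEq (m₁ , m₂) x = evalMon m₁ x ≡ evalMon m₂ x

Sat : ∀ {m} → List (Equation m) → Point m → Set
Sat E x = All (λ e → SatEq e x) E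

NonEmptyMon : ∀ {m} → Monomial m → Set
NonEmptyMon mo = ¬ (mo ≡ [])

NoConstEq : ∀ {m} → Equation m → Set
NoConstEq (m₁ , m₂) = NonEmptyMon m₁ × NonEmptyMon m₂

IsSolSet : ∀ {m} → List (Equation m) → BSet m → Set
IsSolSet E S = ∀ x → (mem S x ≡ true) ⇔ Sat E x

Realizable₀ : ∀ m → BSet m → Set
Realizable₀ m S = Σ (List (Equation m)) λ E → All NoConstEq E × IsSolSet E S

Realizable₁ : ∀ m → BSet m → Set
Realizable₁ m S = Σ (List (Equation m)) λ E → IsSolSet E S

CountOf : ∀ m → (BSet m → Set) → ℕ → Set
CountOf m P c = Σ (List (BSet m)) λ L →
  Unique L × (∀ S → (S ∈ L) ⇔ P S) × (length L ≡ c)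

IsH : ℕ → ℕ → Set
IsH m c = CountOf m (Realizable₀ m) c

IsH₁ : ℕ → ℕ → Set
IsH₁ m c = CountOf m (Realizable₁ m) c

sumTo : ℕ → (ℕ → ℕ) → ℕ
sumTo zero    f = f 0
sumTo (suc n) f = sumTo n f + f (suc n)

-- Solution sets of binomial equations in which the constant 1 may occur are exactly the
-- Moore families of {0,1}^n: the sets containing the all-ones point and closed under
-- pointwise ∧. Conversely a Moore family S is cut out by the equations x^t = x^(cl t) for
-- t ∉ S, where cl t is the least member of S above t. Forbidding constants adds exactly
-- the condition that the all-zeros point lies in S, i.e. that the meet of S is 0.
-- A Moore family whose meet K has a 1 at coordinate i lies in the hyperplane x_i = 1, so
-- the Moore families with meet K correspond to the constant-free ones on the k coordinates
-- where K is 0: there are H(k) of them, for each of the C(n,k) such K.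

module Submission where

open import Defs
open import Data.Nat using (ℕ; zero; suc; _+_; _*_; _≤_)
open import Data.Nat.Properties using (+-identityʳ; +-comm; +-assoc; *-distribʳ-+; n<1+n; +-commutativeSemigroup)
open import Algebra.Properties.CommutativeSemigroup +-commutativeSemigroup
  using () renaming (interchange to +-interchange)
open import Data.Nat.Combinatorics using (_C_; nCk+nC[k+1]≡[n+1]C[k+1]; k>n⇒nCk≡0)
open import Data.Product using (Σ; _×_; _,_; proj₁; proj₂; ∃; ∃₂)
open import Data.Bool using (Bool; true; false; _∧_; not)
open import Data.Bool.Properties using (∧-identityʳ; ∧-zeroʳ; ∧-commutativeMonoid)
open import Data.Fin using (Fin; zero; suc)
open import Data.Vec using ([]; _∷_; lookup; replicate; zipWith; insertAt; removeAt; countᵇ)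
open import Data.Vec.Properties using (lookup-zipWith; lookup-replicate; insertAt-lookup; removeAt-insertAt)
import Data.Vec.Properties as Vec
open import Data.List using (List; []; _∷_; map; _++_; filter; length; cartesianProduct)
open import Data.Nat.ListAction using (sum)
open import Data.Nat.ListAction.Properties using (sum-++)
import Data.List.Properties as List
open import Data.List.Relation.Unary.Any using (here; there)
open import Data.List.Relation.Unary.Unique.Propositional using (Unique)
import Data.List.Relation.Unary.Unique.Propositional.Properties as Unique
open import Data.List.Relation.Unary.All using (All; []; _∷_)
open import Data.List.Relation.Unary.AllPairs using ([]; _∷_)
import Data.List.Relation.Unary.All as All
import Data.List.Relation.Unary.All.Properties as All
open import Data.List.Membership.Propositional using (_∈_)
open import Data.List.Membership.Propositional.Properties
  using (∈-map⁺; ∈-++⁺ˡ; ∈-++⁺ʳ; ∈-filter⁺; ∈-filter⁻; ∈-cartesianProduct⁺)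
open import Data.Sum using (_⊎_; inj₁; inj₂)
open import Data.Empty using (⊥; ⊥-elim)
open import Relation.Nullary using (¬_; Dec; yes; no; does)
import Relation.Nullary.Decidable as Dec
import Data.Bool as Bool
open import Relation.Binary.PropositionalEquality
open import Relation.Binary.Definitions using (DecidableEquality)
open import Function using (_∘_)
open import Function.Bundles using (_⇔_; mk⇔; Equivalence)
open import Algebra.Bundles using (CommutativeMonoid)
open import Algebra.Properties.CommutativeSemigroup
  (CommutativeMonoid.commutativeSemigroup ∧-commutativeMonoid)
  using () renaming (interchange to ∧-interchange)

∧-≡-true : ∀ {a b} → a ∧ b ≡ true → a ≡ true × b ≡ true
∧-≡-true {true} {true} _ = refl , refl

∧-≡-true⁺ : ∀ {a b} → a ≡ true → b ≡ true → a ∧ b ≡ true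
∧-≡-true⁺ refl refl = refl

≡-true-ext : ∀ {a b} → (a ≡ true → b ≡ true) → (b ≡ true → a ≡ true) → a ≡ b
≡-true-ext {true}  a⇒b _ = sym (a⇒b refl)
≡-true-ext {false} {true} _ b⇒a = b⇒a refl
≡-true-ext {false} {false} _ _ = refl

ones zeros : ∀ m → Point m
ones m = replicate m true
zeros m = replicate m false

infixr 7 _⊓_
_⊓_ : ∀ {m} → Point m → Point m → Point m
_⊓_ = zipWith _∧_

⊓-identityʳ : ∀ {m} (u : Point m) → u ⊓ ones m ≡ u
⊓-identityʳ [] = refl
⊓-identityʳ (a ∷ u) = cong₂ _∷_ (∧-identityʳ a) (⊓-identityʳ u)

⊓-identityˡ : ∀ {m} (u : Point m) → ones m ⊓ u ≡ u
⊓-identityˡ [] = refl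
⊓-identityˡ (a ∷ u) = cong (a ∷_) (⊓-identityˡ u)

insertAt-replicate : ∀ {A : Set} {m} (i : Fin (suc m)) (a : A) → insertAt (replicate m a) i a ≡ replicate (suc m) a
insertAt-replicate zero          a = refl
insertAt-replicate {m = suc m} (suc i) a = cong (a ∷_) (insertAt-replicate i a)

insertAt-⊓ : ∀ {m} (i : Fin (suc m)) (u v : Point m) a b →
  insertAt (u ⊓ v) i (a ∧ b) ≡ insertAt u i a ⊓ insertAt v i b
insertAt-⊓ zero    u       v       a b = refl
insertAt-⊓ (suc i) (c ∷ u) (d ∷ v) a b = cong (c ∧ d ∷_) (insertAt-⊓ i u v a b)

_≟ᵖ_ : ∀ {m} → DecidableEquality (Point m)
_≟ᵖ_ = Vec.≡-dec Bool._≟_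

insertAt-≟ᵖ : ∀ {m} (i : Fin (suc m)) (u v : Point m) →
  does (insertAt u i true ≟ᵖ insertAt v i true) ≡ does (u ≟ᵖ v)
insertAt-≟ᵖ i u v = Dec.does-⇔ (mk⇔ insertAt-injective (cong λ w → insertAt w i true))
  (insertAt u i true ≟ᵖ insertAt v i true) (u ≟ᵖ v)
  where
    insertAt-injective : insertAt u i true ≡ insertAt v i true → u ≡ v
    insertAt-injective e = begin
      u                               ≡⟨ sym (removeAt-insertAt u i true) ⟩
      removeAt (insertAt u i true) i  ≡⟨ cong (λ w → removeAt w i) e ⟩
      removeAt (insertAt v i true) i  ≡⟨ removeAt-insertAt v i true ⟩
      v                               ∎
      where open ≡-Reasoning

zeros-or-insertAt-true : ∀ {m} (K : Point (suc m)) →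
  K ≡ zeros (suc m) ⊎ ∃₂ λ (i : Fin (suc m)) K′ → K ≡ insertAt K′ i true
zeros-or-insertAt-true {zero}  (true  ∷ []) = inj₂ (zero , [] , refl)
zeros-or-insertAt-true {zero}  (false ∷ []) = inj₁ refl
zeros-or-insertAt-true {suc m} (true  ∷ K)  = inj₂ (zero , K , refl)
zeros-or-insertAt-true {suc m} (false ∷ K)  with zeros-or-insertAt-true K
... | inj₁ K≡zeros          = inj₁ (cong (false ∷_) K≡zeros)
... | inj₂ (i , K′ , K≡ins) = inj₂ (suc i , false ∷ K′ , cong (false ∷_) K≡ins)

zeroCount : ∀ {m} → Point m → ℕ
zeroCount = countᵇ not

zeroCount-zeros : ∀ m → zeroCount (zeros m) ≡ m
zeroCount-zeros zero    = refl
zeroCount-zeros (suc m) = cong suc (zeroCount-zeros m)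

zeroCount-insertAt : ∀ {m} (i : Fin (suc m)) (K : Point m) → zeroCount (insertAt K i true) ≡ zeroCount K
zeroCount-insertAt zero    K           = refl
zeroCount-insertAt (suc i) (true  ∷ K) = zeroCount-insertAt i K
zeroCount-insertAt (suc i) (false ∷ K) = cong suc (zeroCount-insertAt i K)

all? : ∀ {m} {P : Point m → Set} → (∀ x → Dec (P x)) → Dec (∀ x → P x)
all? {zero}  P? = Dec.map′ (λ { p [] → p }) (λ h → h []) (P? [])
all? {suc m} P? = Dec.map′
  (λ { (t , f) (true ∷ x) → t x ; (t , f) (false ∷ x) → f x })
  (λ h → (h ∘ (true ∷_)) , (h ∘ (false ∷_)))
  (all? (P? ∘ (true ∷_)) Dec.×-dec all? (P? ∘ (false ∷_)))

any? : ∀ {m} {P : Point m → Set} → (∀ x → Dec (P x)) → Dec (∃ P)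
any? {zero}  P? = Dec.map′ ([] ,_) (λ { ([] , p) → p }) (P? [])
any? {suc m} P? = Dec.map′
  (λ { (inj₁ (x , p)) → true ∷ x , p ; (inj₂ (x , p)) → false ∷ x , p })
  (λ { (true ∷ x , p) → inj₁ (x , p) ; (false ∷ x , p) → inj₂ (x , p) })
  (any? (P? ∘ (true ∷_)) Dec.⊎-dec any? (P? ∘ (false ∷_)))

infix 4.5 _≤ᵇ_
_≤ᵇ_ : ∀ {m} → Point m → Point m → Bool
[]      ≤ᵇ []           = true
(a ∷ u) ≤ᵇ (true  ∷ v) = u ≤ᵇ v
(a ∷ u) ≤ᵇ (false ∷ v) = not a ∧ (u ≤ᵇ v)

≤ᵇ-tail : ∀ {m} a b (u v : Point m) → a ∷ u ≤ᵇ b ∷ v ≡ true → u ≤ᵇ v ≡ true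
≤ᵇ-tail a true  u v p = p
≤ᵇ-tail a false u v p = proj₂ (∧-≡-true {not a} p)

≤ᵇ-refl : ∀ {m} (u : Point m) → u ≤ᵇ u ≡ true
≤ᵇ-refl []          = refl
≤ᵇ-refl (true  ∷ u) = ≤ᵇ-refl u
≤ᵇ-refl (false ∷ u) = ≤ᵇ-refl u

≤ᵇ-trans : ∀ {m} {u v w : Point m} → u ≤ᵇ v ≡ true → v ≤ᵇ w ≡ true → u ≤ᵇ w ≡ true
≤ᵇ-trans {u = []}    {[]}        {[]}        _ _ = refl
≤ᵇ-trans {u = a ∷ u} {true ∷ v}  {true ∷ w}  p q = ≤ᵇ-trans {u = u} p q
≤ᵇ-trans {u = a ∷ u} {false ∷ v} {true ∷ w}  p q = ≤ᵇ-trans {u = u} (≤ᵇ-tail a false u v p) q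
≤ᵇ-trans {u = a ∷ u} {false ∷ v} {false ∷ w} p q =
  let ¬a , u≤v = ∧-≡-true {not a} p in ∧-≡-true⁺ ¬a (≤ᵇ-trans {u = u} u≤v (proj₂ (∧-≡-true q)))

≤ᵇ-antisym : ∀ {m} {u v : Point m} → u ≤ᵇ v ≡ true → v ≤ᵇ u ≡ true → u ≡ v
≤ᵇ-antisym {u = []}        {[]}        _ _ = refl
≤ᵇ-antisym {u = true ∷ u}  {true ∷ v}  p q = cong (true ∷_) (≤ᵇ-antisym p q)
≤ᵇ-antisym {u = false ∷ u} {false ∷ v} p q = cong (false ∷_) (≤ᵇ-antisym p q)

≤ᵇ-ones : ∀ {m} (u : Point m) → u ≤ᵇ ones m ≡ true
≤ᵇ-ones []      = refl
≤ᵇ-ones (a ∷ u) = ≤ᵇ-ones u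

zeros-≤ᵇ : ∀ {m} (u : Point m) → zeros m ≤ᵇ u ≡ true
zeros-≤ᵇ []          = refl
zeros-≤ᵇ (true  ∷ u) = zeros-≤ᵇ u
zeros-≤ᵇ (false ∷ u) = zeros-≤ᵇ u

⊓-≤ᵇˡ : ∀ {m} (u v : Point m) → u ⊓ v ≤ᵇ u ≡ true
⊓-≤ᵇˡ []          []      = refl
⊓-≤ᵇˡ (true  ∷ u) (b ∷ v) = ⊓-≤ᵇˡ u v
⊓-≤ᵇˡ (false ∷ u) (b ∷ v) = ⊓-≤ᵇˡ u v

⊓-≤ᵇʳ : ∀ {m} (u v : Point m) → u ⊓ v ≤ᵇ v ≡ true
⊓-≤ᵇʳ []      []          = refl
⊓-≤ᵇʳ (a ∷ u) (true  ∷ v) = ⊓-≤ᵇʳ u v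
⊓-≤ᵇʳ (a ∷ u) (false ∷ v) rewrite ∧-zeroʳ a = ⊓-≤ᵇʳ u v

⊓-greatest : ∀ {m} {t u v : Point m} → t ≤ᵇ u ≡ true → t ≤ᵇ v ≡ true → t ≤ᵇ u ⊓ v ≡ true
⊓-greatest {t = []}    {[]}        {[]}        _ _ = refl
⊓-greatest {t = a ∷ t} {true ∷ u}  {true ∷ v}  p q = ⊓-greatest {t = t} p q
⊓-greatest {t = a ∷ t} {true ∷ u}  {false ∷ v} p q =
  let ¬a , t≤v = ∧-≡-true {not a} q in ∧-≡-true⁺ ¬a (⊓-greatest {t = t} p t≤v)
⊓-greatest {t = a ∷ t} {false ∷ u} {b ∷ v}     p q =
  let ¬a , t≤u = ∧-≡-true {not a} p in ∧-≡-true⁺ ¬a (⊓-greatest {t = t} t≤u (≤ᵇ-tail a b t v q))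

support : ∀ {m} → Point m → Monomial m
support []          = []
support (true  ∷ t) = zero ∷ map suc (support t)
support (false ∷ t) = map suc (support t)

evalMon-map-suc : ∀ {m} (vs : Monomial m) b (x : Point m) → evalMon (map suc vs) (b ∷ x) ≡ evalMon vs x
evalMon-map-suc []       b x = refl
evalMon-map-suc (v ∷ vs) b x = cong (lookup x v ∧_) (evalMon-map-suc vs b x)

evalMon-support : ∀ {m} (t x : Point m) → evalMon (support t) x ≡ t ≤ᵇ x
evalMon-support []          []          = refl
evalMon-support (true  ∷ t) (true  ∷ x) = trans (evalMon-map-suc (support t) true x) (evalMon-support t x)
evalMon-support (true  ∷ t) (false ∷ x) = refl
evalMon-support (false ∷ t) (true  ∷ x) = trans (evalMon-map-suc (support t) true x) (evalMon-support t x)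
evalMon-support (false ∷ t) (false ∷ x) = trans (evalMon-map-suc (support t) false x) (evalMon-support t x)

support-≡[] : ∀ {m} (t : Point m) → support t ≡ [] → t ≡ zeros m
support-≡[] {m} t e = ≤ᵇ-antisym
  (trans (sym (evalMon-support t (zeros m))) (cong (λ vs → evalMon vs (zeros m)) e))
  (zeros-≤ᵇ t)

evalMon-⊓ : ∀ {m} (vs : Monomial m) (x y : Point m) → evalMon vs (x ⊓ y) ≡ evalMon vs x ∧ evalMon vs y
evalMon-⊓ []       x y = refl
evalMon-⊓ (v ∷ vs) x y = begin
  lookup (x ⊓ y) v ∧ evalMon vs (x ⊓ y)
    ≡⟨ cong₂ _∧_ (lookup-zipWith _∧_ v x y) (evalMon-⊓ vs x y) ⟩
  (lookup x v ∧ lookup y v) ∧ (evalMon vs x ∧ evalMon vs y)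
    ≡⟨ ∧-interchange (lookup x v) (lookup y v) (evalMon vs x) (evalMon vs y) ⟩
  (lookup x v ∧ evalMon vs x) ∧ (lookup y v ∧ evalMon vs y) ∎
  where open ≡-Reasoning

evalMon-ones : ∀ {m} (vs : Monomial m) → evalMon vs (ones m) ≡ true
evalMon-ones []       = refl
evalMon-ones (v ∷ vs) rewrite lookup-replicate v true = evalMon-ones vs

evalMon-zeros : ∀ {m} (vs : Monomial m) → NonEmptyMon vs → evalMon vs (zeros m) ≡ false
evalMon-zeros []       ne = ⊥-elim (ne refl)
evalMon-zeros (v ∷ vs) _  rewrite lookup-replicate v false = refl

infix 4 _∈ᶠ_
_∈ᶠ_ : ∀ {m} → Point m → BSet m → Set
x ∈ᶠ G = mem G x ≡ true

NonEmpty : ∀ {m} → BSet m → Set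
NonEmpty G = ∃ λ x → x ∈ᶠ G

Closed : ∀ {m} → BSet m → Set
Closed G = ∀ x y → x ∈ᶠ G → y ∈ᶠ G → x ⊓ y ∈ᶠ G

IsMoore : ∀ {m} → BSet m → Set
IsMoore {m} G = ones m ∈ᶠ G × Closed G

empty : ∀ m → BSet m
empty zero    = false
empty (suc m) = empty m , empty m

mem-empty : ∀ {m} (x : Point m) → mem (empty m) x ≡ false
mem-empty []          = refl
mem-empty (true  ∷ x) = mem-empty x
mem-empty (false ∷ x) = mem-empty x

empty-¬nonEmpty : ∀ m → ¬ NonEmpty (empty m)
empty-¬nonEmpty m (x , x∈) with () ← trans (sym (mem-empty x)) x∈

¬nonEmpty⇒≡empty : ∀ {m} (G : BSet m) → ¬ NonEmpty G → G ≡ empty m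
¬nonEmpty⇒≡empty {zero}  true    ¬G = ⊥-elim (¬G ([] , refl))
¬nonEmpty⇒≡empty {zero}  false   ¬G = refl
¬nonEmpty⇒≡empty {suc m} (t , f) ¬G = cong₂ _,_
  (¬nonEmpty⇒≡empty t λ (x , x∈) → ¬G (true ∷ x , x∈))
  (¬nonEmpty⇒≡empty f λ (x , x∈) → ¬G (false ∷ x , x∈))

closed-trueBranch : ∀ {m} {t f : BSet m} → Closed (t , f) → Closed t
closed-trueBranch closed x y = closed (true ∷ x) (true ∷ y)

closed-falseBranch : ∀ {m} {t f : BSet m} → Closed (t , f) → Closed f
closed-falseBranch closed x y = closed (false ∷ x) (false ∷ y)

tabulateᶠ : ∀ {m} → (Point m → Bool) → BSet m
tabulateᶠ {zero}  p = p []
tabulateᶠ {suc m} p = tabulateᶠ (p ∘ (true ∷_)) , tabulateᶠ (p ∘ (false ∷_))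

mem-tabulateᶠ : ∀ {m} (p : Point m → Bool) (x : Point m) → mem (tabulateᶠ p) x ≡ p x
mem-tabulateᶠ p []          = refl
mem-tabulateᶠ p (true  ∷ x) = mem-tabulateᶠ (p ∘ (true ∷_)) x
mem-tabulateᶠ p (false ∷ x) = mem-tabulateᶠ (p ∘ (false ∷_)) x

nonEmpty? : ∀ {m} (G : BSet m) → Dec (NonEmpty G)
nonEmpty? G = any? (λ x → mem G x Bool.≟ true)

⋀ : ∀ {m} → BSet m → Point m
⋀ {zero}  _       = []
⋀ {suc m} (t , f) = not (does (nonEmpty? f)) ∷ ⋀ t ⊓ ⋀ f

⋀-ones : ∀ {m} (G : BSet m) → ¬ NonEmpty G → ⋀ G ≡ ones m
⋀-ones {zero}  G       _  = refl
⋀-ones {suc m} (t , f) ¬G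
  rewrite Dec.dec-false (nonEmpty? f) (λ (x , p) → ¬G (false ∷ x , p))
        | ⋀-ones t (λ (x , p) → ¬G (true ∷ x , p))
        | ⋀-ones f (λ (x , p) → ¬G (false ∷ x , p)) = cong (true ∷_) (⊓-identityʳ (ones m))

⋀-lower : ∀ {m} (G : BSet m) {x} → x ∈ᶠ G → ⋀ G ≤ᵇ x ≡ true
⋀-lower {zero}  G       {[]}        _ = refl
⋀-lower {suc m} (t , f) {true  ∷ x} p = ≤ᵇ-trans {u = ⋀ t ⊓ ⋀ f} (⊓-≤ᵇˡ (⋀ t) (⋀ f)) (⋀-lower t p)
⋀-lower {suc m} (t , f) {false ∷ x} p rewrite Dec.dec-true (nonEmpty? f) (x , p) =
  ≤ᵇ-trans {u = ⋀ t ⊓ ⋀ f} (⊓-≤ᵇʳ (⋀ t) (⋀ f)) (⋀-lower f p)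

⋀-∈ : ∀ {m} (G : BSet m) → Closed G → NonEmpty G → ⋀ G ∈ᶠ G
⋀-∈ {zero}  G       _ ([] , p) = p
⋀-∈ {suc m} (t , f) c (x , p) with nonEmpty? f
⋀-∈ {suc m} (t , f) c (true  ∷ x , p) | no ¬f
  rewrite ⋀-ones f ¬f | ⊓-identityʳ (⋀ t) = ⋀-∈ t (closed-trueBranch c) (x , p)
⋀-∈ {suc m} (t , f) c (false ∷ x , p) | no ¬f = ⊥-elim (¬f (x , p))
... | yes nf with nonEmpty? t
...   | no ¬t rewrite ⋀-ones t ¬t | ⊓-identityˡ (⋀ f) = ⋀-∈ f (closed-falseBranch c) nf
...   | yes nt = c (true ∷ ⋀ t) (false ∷ ⋀ f) (⋀-∈ t (closed-trueBranch c) nt) (⋀-∈ f (closed-falseBranch c) nf)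

-- Solution sets are exactly the Moore families

upperSet : ∀ {m} → BSet m → Point m → BSet m
upperSet S t = tabulateᶠ (λ x → mem S x ∧ (t ≤ᵇ x))

∈-upperSet : ∀ {m} (S : BSet m) t x → x ∈ᶠ upperSet S t ⇔ (x ∈ᶠ S × t ≤ᵇ x ≡ true)
∈-upperSet S t x = mk⇔
  (λ x∈ → ∧-≡-true (trans (sym (mem-tabulateᶠ (λ x → mem S x ∧ (t ≤ᵇ x)) x)) x∈))
  (λ (x∈S , t≤x) → trans (mem-tabulateᶠ (λ x → mem S x ∧ (t ≤ᵇ x)) x) (∧-≡-true⁺ x∈S t≤x))

closure : ∀ {m} → BSet m → Point m → Point m
closure S t = ⋀ (upperSet S t)

allPoints : ∀ m → List (Point m)
allPoints zero    = [] ∷ []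
allPoints (suc m) = map (true ∷_) (allPoints m) ++ map (false ∷_) (allPoints m)

∈-allPoints : ∀ {m} (x : Point m) → x ∈ allPoints m
∈-allPoints []          = here refl
∈-allPoints (true  ∷ x) = ∈-++⁺ˡ (∈-map⁺ (true ∷_) (∈-allPoints x))
∈-allPoints {suc m} (false ∷ x) = ∈-++⁺ʳ (map (true ∷_) (allPoints m)) (∈-map⁺ (false ∷_) (∈-allPoints x))

closureEquation : ∀ {m} → BSet m → Point m → Equation m
closureEquation S t = support t , support (closure S t)

nonMember? : ∀ {m} (S : BSet m) t → Dec (mem S t ≡ false)
nonMember? S t = mem S t Bool.≟ false

-- Members t of S are skipped: for t = zeros their equation would be the constant one 1 = 1.
closureEquations : ∀ {m} → BSet m → List (Equation m)
closureEquations {m} S = map (closureEquation S) (filter (nonMember? S) (allPoints m))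

module _ {m} {S : BSet m} (moore : IsMoore S) where

  upperSet-closed : ∀ t → Closed (upperSet S t)
  upperSet-closed t x y x∈ y∈ =
    let x∈S , t≤x = Equivalence.to (∈-upperSet S t x) x∈
        y∈S , t≤y = Equivalence.to (∈-upperSet S t y) y∈
    in Equivalence.from (∈-upperSet S t (x ⊓ y))
         (proj₂ moore x y x∈S y∈S , ⊓-greatest {t = t} {x} {y} t≤x t≤y)

  closure-upper : ∀ t → closure S t ∈ᶠ upperSet S t
  closure-upper t = ⋀-∈ (upperSet S t) (upperSet-closed t)
    (ones m , Equivalence.from (∈-upperSet S t (ones m)) (proj₁ moore , ≤ᵇ-ones t))

  closure-∈ : ∀ t → closure S t ∈ᶠ S
  closure-∈ t = proj₁ (Equivalence.to (∈-upperSet S t (closure S t)) (closure-upper t))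

  closure-extensive : ∀ t → t ≤ᵇ closure S t ≡ true
  closure-extensive t = proj₂ (Equivalence.to (∈-upperSet S t (closure S t)) (closure-upper t))

  closure-least : ∀ t {x} → x ∈ᶠ S → t ≤ᵇ x ≡ true → closure S t ≤ᵇ x ≡ true
  closure-least t {x} x∈S t≤x = ⋀-lower (upperSet S t) (Equivalence.from (∈-upperSet S t x) (x∈S , t≤x))

  closureEquations-solutionSet : IsSolSet (closureEquations S) S
  closureEquations-solutionSet x = mk⇔ sat sat⇒∈
    where
      sat : x ∈ᶠ S → Sat (closureEquations S) x
      sat x∈S = All.map⁺ (All.universal holds _)
        where
          holds : ∀ t → SatEq (closureEquation S t) x
          holds t = begin
            evalMon (support t) x               ≡⟨ evalMon-support t x ⟩
            t ≤ᵇ x                              ≡⟨ ≡-true-ext (closure-least t x∈S)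
                                                     (≤ᵇ-trans {u = t} (closure-extensive t)) ⟩
            closure S t ≤ᵇ x                    ≡⟨ sym (evalMon-support (closure S t) x) ⟩
            evalMon (support (closure S t)) x   ∎
            where open ≡-Reasoning

      sat⇒∈ : Sat (closureEquations S) x → x ∈ᶠ S
      sat⇒∈ s with mem S x in x∉S
      ... | true  = refl
      ... | false = trans (sym x∉S) (trans (cong (mem S) x≡cl) (closure-∈ x))
        where
          equation : evalMon (support x) x ≡ evalMon (support (closure S x)) x
          equation = All.lookup (All.map⁻ s) (∈-filter⁺ (nonMember? S) (∈-allPoints x) x∉S)
          x≡cl : x ≡ closure S x
          x≡cl = ≤ᵇ-antisym (closure-extensive x)
            (trans (sym (evalMon-support (closure S x) x))
              (trans (sym equation) (trans (evalMon-support x x) (≤ᵇ-refl x))))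

  closureEquations-noConst : zeros m ∈ᶠ S → All NoConstEq (closureEquations S)
  closureEquations-noConst zeros∈S =
    All.map⁺ (All.tabulate (λ t∈ → noConst (proj₂ (∈-filter⁻ (nonMember? S) {xs = allPoints m} t∈))))
    where
      ≢zeros : ∀ {t} → mem S t ≡ false → t ≡ zeros m → ⊥
      ≢zeros t∉S refl with () ← trans (sym t∉S) zeros∈S

      noConst : ∀ {t} → mem S t ≡ false → NoConstEq (closureEquation S t)
      noConst {t} t∉S =
          (λ e → ≢zeros t∉S (support-≡[] t e))
        , (λ e → ≢zeros t∉S (≤ᵇ-antisym
                   (subst (λ u → t ≤ᵇ u ≡ true) (support-≡[] (closure S t) e) (closure-extensive t))
                   (zeros-≤ᵇ t)))

Sat-⊓ : ∀ {m} (E : List (Equation m)) {x y} → Sat E x → Sat E y → Sat E (x ⊓ y)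
Sat-⊓ E {x} {y} sx sy = All.zipWith
  (λ { {m₁ , m₂} (p , q) → trans (evalMon-⊓ m₁ x y) (trans (cong₂ _∧_ p q) (sym (evalMon-⊓ m₂ x y))) })
  (sx , sy)

Sat-ones : ∀ {m} (E : List (Equation m)) → Sat E (ones m)
Sat-ones = All.universal (λ (m₁ , m₂) → trans (evalMon-ones m₁) (sym (evalMon-ones m₂)))

Sat-zeros : ∀ {m} {E : List (Equation m)} → All NoConstEq E → Sat E (zeros m)
Sat-zeros = All.map (λ { {m₁ , m₂} (n₁ , n₂) → trans (evalMon-zeros m₁ n₁) (sym (evalMon-zeros m₂ n₂)) })

solutionSet-isMoore : ∀ {m} {E : List (Equation m)} {S} → IsSolSet E S → IsMoore S
solutionSet-isMoore {m} {E} sol =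
    Equivalence.from (sol (ones m)) (Sat-ones E)
  , λ x y x∈ y∈ → Equivalence.from (sol (x ⊓ y))
                    (Sat-⊓ E (Equivalence.to (sol x) x∈) (Equivalence.to (sol y) y∈))

realizable₁⇔isMoore : ∀ {m} (S : BSet m) → Realizable₁ m S ⇔ IsMoore S
realizable₁⇔isMoore S = mk⇔
  (λ (E , sol) → solutionSet-isMoore sol)
  (λ moore → closureEquations S , closureEquations-solutionSet moore)

realizable₀⇔isMoore×⋀≡zeros : ∀ {m} (S : BSet m) → Realizable₀ m S ⇔ (IsMoore S × ⋀ S ≡ zeros m)
realizable₀⇔isMoore×⋀≡zeros {m} S = mk⇔
  (λ (E , noConst , sol) →
       solutionSet-isMoore sol
     , ≤ᵇ-antisym (⋀-lower S (Equivalence.from (sol (zeros m)) (Sat-zeros noConst))) (zeros-≤ᵇ (⋀ S)))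
  (λ (moore , ⋀≡zeros) →
       closureEquations S
     , closureEquations-noConst moore
         (subst (_∈ᶠ S) ⋀≡zeros (⋀-∈ S (proj₂ moore) (ones m , proj₁ moore)))
     , closureEquations-solutionSet moore)

isMoore? : ∀ {m} (S : BSet m) → Dec (IsMoore S)
isMoore? {m} S = ∈? (ones m) Dec.×-dec all? λ x → all? λ y → ∈? x Dec.→-dec ∈? y Dec.→-dec ∈? (x ⊓ y)
  where
    ∈? : ∀ x → Dec (x ∈ᶠ S)
    ∈? x = mem S x Bool.≟ true

isMooreWithMeet? : ∀ {m} (K : Point m) (F : BSet m) → Dec (IsMoore F × ⋀ F ≡ K)
isMooreWithMeet? K F = isMoore? F Dec.×-dec ⋀ F ≟ᵖ K

realizable₁? : ∀ {m} (S : BSet m) → Dec (Realizable₁ m S)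
realizable₁? S = Dec.map′ (Equivalence.from (realizable₁⇔isMoore S)) (Equivalence.to (realizable₁⇔isMoore S))
  (isMoore? S)

realizable₀? : ∀ {m} (S : BSet m) → Dec (Realizable₀ m S)
realizable₀? {m} S = Dec.map′ (Equivalence.from (realizable₀⇔isMoore×⋀≡zeros S))
  (Equivalence.to (realizable₀⇔isMoore×⋀≡zeros S)) (isMooreWithMeet? (zeros m) S)

indicator : Bool → ℕ
indicator true  = 1
indicator false = 0

sumFamilies : ∀ m → (BSet m → ℕ) → ℕ
sumFamilies zero    h = h true + h false
sumFamilies (suc m) h = sumFamilies m λ t → sumFamilies m λ f → h (t , f)

sumFamilies-cong : ∀ m {g h : BSet m → ℕ} → (∀ S → g S ≡ h S) → sumFamilies m g ≡ sumFamilies m h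
sumFamilies-cong zero    e = cong₂ _+_ (e true) (e false)
sumFamilies-cong (suc m) e = sumFamilies-cong m λ t → sumFamilies-cong m λ f → e (t , f)

sumFamilies-+ : ∀ m (g h : BSet m → ℕ) → sumFamilies m (λ S → g S + h S) ≡ sumFamilies m g + sumFamilies m h
sumFamilies-+ zero    g h = +-interchange (g true) (h true) (g false) (h false)
sumFamilies-+ (suc m) g h = trans (sumFamilies-cong m λ t → sumFamilies-+ m _ _) (sumFamilies-+ m _ _)

sumFamilies-zero : ∀ m (h : BSet m → ℕ) → (∀ S → h S ≡ 0) → sumFamilies m h ≡ 0
sumFamilies-zero zero    h h≡0 = cong₂ _+_ (h≡0 true) (h≡0 false)
sumFamilies-zero (suc m) h h≡0 =
  trans (sumFamilies-cong m λ t → sumFamilies-zero m _ λ f → h≡0 (t , f)) (sumFamilies-zero m _ λ _ → refl)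

sumFamilies-single : ∀ m (h : BSet m → ℕ) S → (∀ S′ → S′ ≢ S → h S′ ≡ 0) → sumFamilies m h ≡ h S
sumFamilies-single zero    h true  h≡0 = trans (cong (h true +_) (h≡0 false λ ())) (+-identityʳ (h true))
sumFamilies-single zero    h false h≡0 = cong (_+ h false) (h≡0 true λ ())
sumFamilies-single (suc m) h (t , f) h≡0 =
  trans (sumFamilies-single m _ t λ t′ t′≢t → sumFamilies-zero m _ λ f′ → h≡0 (t′ , f′) (t′≢t ∘ cong proj₁))
        (sumFamilies-single m _ f λ f′ f′≢f → h≡0 (t , f′) (f′≢f ∘ cong proj₂))

families : ∀ m → List (BSet m)
families zero    = true ∷ false ∷ []
families (suc m) = cartesianProduct (families m) (families m)

families-unique : ∀ m → Unique (families m)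
families-unique zero    = ((λ ()) ∷ []) ∷ [] ∷ []
families-unique (suc m) = Unique.cartesianProduct⁺ (families-unique m) (families-unique m)

∈-families : ∀ {m} (S : BSet m) → S ∈ families m
∈-families {zero}  true    = here refl
∈-families {zero}  false   = there (here refl)
∈-families {suc m} (t , f) = ∈-cartesianProduct⁺ (∈-families t) (∈-families f)

sum-map-cartesianProduct : ∀ {A B : Set} (h : A × B → ℕ) xs ys →
  sum (map h (cartesianProduct xs ys)) ≡ sum (map (λ x → sum (map (λ y → h (x , y)) ys)) xs)
sum-map-cartesianProduct h []       ys = refl
sum-map-cartesianProduct h (x ∷ xs) ys = begin
  sum (map h (map (x ,_) ys ++ cartesianProduct xs ys))
    ≡⟨ cong sum (List.map-++ h (map (x ,_) ys) (cartesianProduct xs ys)) ⟩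
  sum (map h (map (x ,_) ys) ++ map h (cartesianProduct xs ys))
    ≡⟨ sum-++ (map h (map (x ,_) ys)) _ ⟩
  sum (map h (map (x ,_) ys)) + sum (map h (cartesianProduct xs ys))
    ≡⟨ cong₂ _+_ (cong sum (sym (List.map-∘ ys))) (sum-map-cartesianProduct h xs ys) ⟩
  sum (map (λ y → h (x , y)) ys) + sum (map (λ x → sum (map (λ y → h (x , y)) ys)) xs) ∎
  where open ≡-Reasoning

sum-families : ∀ m (h : BSet m → ℕ) → sum (map h (families m)) ≡ sumFamilies m h
sum-families zero    h = cong (h true +_) (+-identityʳ (h false))
sum-families (suc m) h = begin
  sum (map h (cartesianProduct (families m) (families m)))
    ≡⟨ sum-map-cartesianProduct h (families m) (families m) ⟩
  sum (map (λ t → sum (map (λ f → h (t , f)) (families m))) (families m))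
    ≡⟨ cong sum (List.map-cong (λ t → sum-families m (λ f → h (t , f))) (families m)) ⟩
  sum (map (λ t → sumFamilies m λ f → h (t , f)) (families m))
    ≡⟨ sum-families m _ ⟩
  sumFamilies (suc m) h ∎
  where open ≡-Reasoning

length-filter : ∀ {A : Set} {P : A → Set} (P? : ∀ x → Dec (P x)) xs →
  length (filter P? xs) ≡ sum (map (indicator ∘ does ∘ P?) xs)
length-filter P? []       = refl
length-filter P? (x ∷ xs) with does (P? x)
... | true  = cong suc (length-filter P? xs)
... | false = length-filter P? xs

countOf : ∀ m {P : BSet m → Set} (P? : ∀ S → Dec (P S)) → CountOf m P (sumFamilies m (indicator ∘ does ∘ P?))
countOf m P? =
    filter P? (families m)
  , Unique.filter⁺ P? (families-unique m)
  , (λ S → mk⇔ (proj₂ ∘ ∈-filter⁻ P? {xs = families m}) (∈-filter⁺ P? (∈-families S)))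
  , trans (length-filter P? (families m)) (sum-families m _)

sumPoints : ∀ m → (Point m → ℕ) → ℕ
sumPoints zero    h = h []
sumPoints (suc m) h = sumPoints m (h ∘ (true ∷_)) + sumPoints m (h ∘ (false ∷_))

sumPoints-cong : ∀ m {g h : Point m → ℕ} → (∀ K → g K ≡ h K) → sumPoints m g ≡ sumPoints m h
sumPoints-cong zero    g≡h = g≡h []
sumPoints-cong (suc m) g≡h =
  cong₂ _+_ (sumPoints-cong m (g≡h ∘ (true ∷_))) (sumPoints-cong m (g≡h ∘ (false ∷_)))

sumPoints-zero : ∀ m → sumPoints m (λ _ → 0) ≡ 0
sumPoints-zero zero    = refl
sumPoints-zero (suc m) = cong₂ _+_ (sumPoints-zero m) (sumPoints-zero m)

sumPoints-≟ : ∀ {m} (v : Point m) → sumPoints m (λ K → indicator (does (v ≟ᵖ K))) ≡ 1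
sumPoints-≟ []          = refl
sumPoints-≟ {suc m} (true  ∷ v) = cong₂ _+_ (sumPoints-≟ v) (sumPoints-zero m)
sumPoints-≟ {suc m} (false ∷ v) = cong₂ _+_ (sumPoints-zero m) (sumPoints-≟ v)

sumPoints-indicator-≟ : ∀ {m} b (v : Point m) → sumPoints m (λ K → indicator (b ∧ does (v ≟ᵖ K))) ≡ indicator b
sumPoints-indicator-≟ true  v = sumPoints-≟ v
sumPoints-indicator-≟ {m} false v = sumPoints-zero m

sumPoints-sumFamilies-comm : ∀ m m′ (h : BSet m′ → Point m → ℕ) →
  sumPoints m (λ K → sumFamilies m′ (λ F → h F K)) ≡ sumFamilies m′ (λ F → sumPoints m (h F))
sumPoints-sumFamilies-comm zero    m′ h = refl
sumPoints-sumFamilies-comm (suc m) m′ h =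
  trans (cong₂ _+_ (sumPoints-sumFamilies-comm m m′ _) (sumPoints-sumFamilies-comm m m′ _))
        (sym (sumFamilies-+ m′ _ _))

-- Moore families counted by their meet

-- extendAt i G = { insertAt u i true ∣ u ∈ G }
extendAt : ∀ {m} → Fin (suc m) → BSet m → BSet (suc m)
extendAt {m}     zero    G       = G , empty m
extendAt {suc m} (suc i) (a , c) = extendAt i a , extendAt i c

sliceAt : ∀ {m} → Fin (suc m) → BSet (suc m) → BSet m
sliceAt          zero    (t , f) = t
sliceAt {suc m} (suc i) (a , c) = sliceAt i a , sliceAt i c

mem-extendAt : ∀ {m} (i : Fin (suc m)) (G : BSet m) u → mem (extendAt i G) (insertAt u i true) ≡ mem G u
mem-extendAt zero            G       u           = refl
mem-extendAt {suc m} (suc i) (a , c) (true  ∷ u) = mem-extendAt i a u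
mem-extendAt {suc m} (suc i) (a , c) (false ∷ u) = mem-extendAt i c u

∈-extendAt⁻ : ∀ {m} (i : Fin (suc m)) (G : BSet m) {x} → x ∈ᶠ extendAt i G →
  ∃ λ u → x ≡ insertAt u i true × u ∈ᶠ G
∈-extendAt⁻ zero            G       {true  ∷ u} p = u , refl , p
∈-extendAt⁻ zero            G       {false ∷ u} p with () ← trans (sym (mem-empty u)) p
∈-extendAt⁻ {suc m} (suc i) (a , c) {true  ∷ x} p =
  let u , x≡ , u∈ = ∈-extendAt⁻ i a p in true ∷ u , cong (true ∷_) x≡ , u∈
∈-extendAt⁻ {suc m} (suc i) (a , c) {false ∷ x} p =
  let u , x≡ , u∈ = ∈-extendAt⁻ i c p in false ∷ u , cong (false ∷_) x≡ , u∈

nonEmpty-extendAt : ∀ {m} (i : Fin (suc m)) (G : BSet m) → NonEmpty (extendAt i G) ⇔ NonEmpty G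
nonEmpty-extendAt i G = mk⇔
  (λ (x , x∈) → let u , _ , u∈ = ∈-extendAt⁻ i G {x} x∈ in u , u∈)
  (λ (u , u∈) → insertAt u i true , trans (mem-extendAt i G u) u∈)

isMoore-extendAt : ∀ {m} (i : Fin (suc m)) (G : BSet m) → IsMoore (extendAt i G) ⇔ IsMoore G
isMoore-extendAt {m} i G = mk⇔
  (λ (ones∈ , closed) →
       trans (sym mem-ones) ones∈
     , λ u v u∈ v∈ → trans (sym (mem-⊓ u v))
         (closed (insertAt u i true) (insertAt v i true)
                 (trans (mem-extendAt i G u) u∈) (trans (mem-extendAt i G v) v∈)))
  (λ (ones∈ , closed) → trans mem-ones ones∈ , closedExtension closed)
  where
    mem-ones : mem (extendAt i G) (ones (suc m)) ≡ mem G (ones m)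
    mem-ones = trans (cong (mem (extendAt i G)) (sym (insertAt-replicate i true))) (mem-extendAt i G (ones m))

    mem-⊓ : ∀ u v → mem (extendAt i G) (insertAt u i true ⊓ insertAt v i true) ≡ mem G (u ⊓ v)
    mem-⊓ u v = trans (cong (mem (extendAt i G)) (sym (insertAt-⊓ i u v true true))) (mem-extendAt i G (u ⊓ v))

    closedExtension : Closed G → Closed (extendAt i G)
    closedExtension closed x y x∈ y∈
      with ∈-extendAt⁻ i G {x} x∈ | ∈-extendAt⁻ i G {y} y∈
    ... | u , refl , u∈ | v , refl , v∈ = trans (mem-⊓ u v) (closed u v u∈ v∈)

⋀-extendAt : ∀ {m} (i : Fin (suc m)) (G : BSet m) → ⋀ (extendAt i G) ≡ insertAt (⋀ G) i true
⋀-extendAt {m} zero G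
  rewrite Dec.dec-false (nonEmpty? (empty m)) (empty-¬nonEmpty m)
        | ⋀-ones (empty m) (empty-¬nonEmpty m) = cong (true ∷_) (⊓-identityʳ (⋀ G))
⋀-extendAt {suc m} (suc i) (a , c) = cong₂ _∷_
  (cong not (Dec.does-⇔ (nonEmpty-extendAt i c) (nonEmpty? (extendAt i c)) (nonEmpty? c)))
  (trans (cong₂ _⊓_ (⋀-extendAt i a) (⋀-extendAt i c)) (sym (insertAt-⊓ i (⋀ a) (⋀ c) true true)))

≡-extendAt-sliceAt : ∀ {m} (i : Fin (suc m)) (F : BSet (suc m)) →
  lookup (⋀ F) i ≡ true → F ≡ extendAt i (sliceAt i F)
≡-extendAt-sliceAt zero (t , f) head≡true with nonEmpty? f
... | no ¬f = cong (t ,_) (¬nonEmpty⇒≡empty f ¬f)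
≡-extendAt-sliceAt {suc m} (suc i) (a , c) ith≡true
  with ∧-≡-true (trans (sym (lookup-zipWith _∧_ i (⋀ a) (⋀ c))) ith≡true)
... | a≡ , c≡ = cong₂ _,_ (≡-extendAt-sliceAt i a a≡) (≡-extendAt-sliceAt i c c≡)

sumFamilies-extendAt : ∀ m (i : Fin (suc m)) (h : BSet (suc m) → ℕ) →
  (∀ F → F ≢ extendAt i (sliceAt i F) → h F ≡ 0) →
  sumFamilies (suc m) h ≡ sumFamilies m (h ∘ extendAt i)
sumFamilies-extendAt m zero h h≡0 = sumFamilies-cong m λ t →
  sumFamilies-single m _ (empty m) λ f f≢∅ → h≡0 (t , f) (f≢∅ ∘ cong proj₂)
sumFamilies-extendAt (suc m) (suc i) h h≡0 =
  trans (sumFamilies-cong (suc m) λ a → sumFamilies-extendAt m i _ λ c c≢ → h≡0 (a , c) (c≢ ∘ cong proj₂))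
        (sumFamilies-extendAt m i _ λ a a≢ → sumFamilies-zero m _ λ c → h≡0 (a , extendAt i c) (a≢ ∘ cong proj₁))

#moore : ∀ m → ℕ
#moore m = sumFamilies m (indicator ∘ does ∘ isMoore?)

#mooreWithMeet : ∀ {m} → Point m → ℕ
#mooreWithMeet {m} K = sumFamilies m (indicator ∘ does ∘ isMooreWithMeet? K)

#moore≡sumPoints-#mooreWithMeet : ∀ m → #moore m ≡ sumPoints m #mooreWithMeet
#moore≡sumPoints-#mooreWithMeet m =
  trans (sumFamilies-cong m λ F → sym (sumPoints-indicator-≟ (does (isMoore? F)) (⋀ F)))
        (sym (sumPoints-sumFamilies-comm m m _))

#mooreWithMeet-insertAt : ∀ {m} (i : Fin (suc m)) (K : Point m) → #mooreWithMeet (insertAt K i true) ≡ #mooreWithMeet K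
#mooreWithMeet-insertAt {m} i K =
  trans (sumFamilies-extendAt m i _ outsideImage)
        (sumFamilies-cong m λ G → cong indicator (cong₂ _∧_
          (Dec.does-⇔ (isMoore-extendAt i G) (isMoore? (extendAt i G)) (isMoore? G))
          (trans (cong (λ w → does (w ≟ᵖ insertAt K i true)) (⋀-extendAt i G)) (insertAt-≟ᵖ i (⋀ G) K))))
  where
    outsideImage : ∀ F → F ≢ extendAt i (sliceAt i F) →
                   indicator (does (isMooreWithMeet? (insertAt K i true) F)) ≡ 0
    outsideImage F F≢ = cong indicator (Dec.dec-false (isMooreWithMeet? (insertAt K i true) F) λ (_ , ⋀≡) →
      F≢ (≡-extendAt-sliceAt i F (trans (cong (λ w → lookup w i) ⋀≡) (insertAt-lookup K i true))))

#mooreWithMeet-zeroCount : ∀ {m} (K : Point m) → #mooreWithMeet K ≡ #mooreWithMeet (zeros (zeroCount K))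
#mooreWithMeet-zeroCount {zero}  [] = refl
#mooreWithMeet-zeroCount {suc m} K with zeros-or-insertAt-true K
... | inj₁ refl = cong (#mooreWithMeet ∘ zeros) (sym (zeroCount-zeros (suc m)))
... | inj₂ (i , K′ , refl) = begin
  #mooreWithMeet (insertAt K′ i true)
    ≡⟨ #mooreWithMeet-insertAt i K′ ⟩
  #mooreWithMeet K′
    ≡⟨ #mooreWithMeet-zeroCount K′ ⟩
  #mooreWithMeet (zeros (zeroCount K′))
    ≡⟨ cong (#mooreWithMeet ∘ zeros) (sym (zeroCount-insertAt i K′)) ⟩
  #mooreWithMeet (zeros (zeroCount (insertAt K′ i true))) ∎
  where open ≡-Reasoning

-- The binomial sum

sumTo-cong : ∀ n {f g : ℕ → ℕ} → (∀ k → f k ≡ g k) → sumTo n f ≡ sumTo n g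
sumTo-cong zero    f≡g = f≡g 0
sumTo-cong (suc n) f≡g = cong₂ _+_ (sumTo-cong n f≡g) (f≡g (suc n))

sumTo-+ : ∀ n (f g : ℕ → ℕ) → sumTo n (λ k → f k + g k) ≡ sumTo n f + sumTo n g
sumTo-+ zero    f g = refl
sumTo-+ (suc n) f g = trans (cong (_+ (f (suc n) + g (suc n))) (sumTo-+ n f g))
                            (+-interchange (sumTo n f) (sumTo n g) (f (suc n)) (g (suc n)))

sumTo-shift : ∀ n (f : ℕ → ℕ) → sumTo (suc n) f ≡ f 0 + sumTo n (f ∘ suc)
sumTo-shift zero    f = refl
sumTo-shift (suc n) f = trans (cong (_+ f (suc (suc n))) (sumTo-shift n f)) (+-assoc (f 0) _ _)

sumTo-binomial-extend : ∀ m (g : ℕ → ℕ) → sumTo (suc m) (λ k → (m C k) * g k) ≡ sumTo m (λ k → (m C k) * g k)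
sumTo-binomial-extend m g = trans (cong (λ c → sumTo m (λ k → (m C k) * g k) + c * g (suc m)) (k>n⇒nCk≡0 (n<1+n m)))
                                  (+-identityʳ _)

sumTo-pascal : ∀ m (g : ℕ → ℕ) →
  sumTo (suc m) (λ k → (suc m C k) * g k) ≡ sumTo m (λ k → (m C k) * g k) + sumTo m (λ k → (m C k) * g (suc k))
sumTo-pascal m g = begin
  sumTo (suc m) (λ k → (suc m C k) * g k)
    ≡⟨ sumTo-shift m _ ⟩
  1 * g 0 + sumTo m (λ k → (suc m C suc k) * g (suc k))
    ≡⟨ cong (1 * g 0 +_) (sumTo-cong m pascal) ⟩
  1 * g 0 + sumTo m (λ k → (m C k) * g (suc k) + (m C suc k) * g (suc k))
    ≡⟨ cong (1 * g 0 +_) (sumTo-+ m _ _) ⟩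
  1 * g 0 + (B + B′)
    ≡⟨ cong (1 * g 0 +_) (+-comm B B′) ⟩
  1 * g 0 + (B′ + B)
    ≡⟨ sym (+-assoc (1 * g 0) B′ B) ⟩
  (1 * g 0 + B′) + B
    ≡⟨ cong (_+ B) (sym A≡) ⟩
  sumTo m (λ k → (m C k) * g k) + B ∎
  where
    open ≡-Reasoning
    B  = sumTo m (λ k → (m C k) * g (suc k))
    B′ = sumTo m (λ k → (m C suc k) * g (suc k))
    A≡ : sumTo m (λ k → (m C k) * g k) ≡ 1 * g 0 + B′
    A≡ = trans (sym (sumTo-binomial-extend m g)) (sumTo-shift m _)
    pascal : ∀ k → (suc m C suc k) * g (suc k) ≡ (m C k) * g (suc k) + (m C suc k) * g (suc k)
    pascal k = trans (cong (_* g (suc k)) (sym (nCk+nC[k+1]≡[n+1]C[k+1] m k)))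
                     (*-distribʳ-+ (g (suc k)) (m C k) (m C suc k))

sumPoints-zeroCount : ∀ m (g : ℕ → ℕ) → sumPoints m (g ∘ zeroCount) ≡ sumTo m (λ k → (m C k) * g k)
sumPoints-zeroCount zero    g = sym (+-identityʳ (g 0))
sumPoints-zeroCount (suc m) g =
  trans (cong₂ _+_ (sumPoints-zeroCount m g) (sumPoints-zeroCount m (g ∘ suc))) (sym (sumTo-pascal m g))

mainTheorem3 : (n : ℕ) →
    Σ ℕ λ h₁ → Σ (ℕ → ℕ) λ h →
      IsH₁ n h₁ × (∀ k → k ≤ n → IsH k (h k)) ×
      (h₁ ≡ sumTo n (λ k → (n C k) * h k))
mainTheorem3 n =
    #moore n
  , #mooreWithMeet ∘ zeros
  , countOf n realizable₁?
  , (λ k _ → countOf k realizable₀?)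
  , (begin
      #moore n                                          ≡⟨ #moore≡sumPoints-#mooreWithMeet n ⟩
      sumPoints n #mooreWithMeet                        ≡⟨ sumPoints-cong n #mooreWithMeet-zeroCount ⟩
      sumPoints n (#mooreWithMeet ∘ zeros ∘ zeroCount)  ≡⟨ sumPoints-zeroCount n (#mooreWithMeet ∘ zeros) ⟩
      sumTo n (λ k → (n C k) * #mooreWithMeet (zeros k)) ∎)
  where open ≡-Reasoning
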